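{- Let $\Gamma$ be a finite group and $H$ a subgroup of $\Gamma$ with $\overline{D}(H)=c<\infty$, and let $A$ be the set of all pairs $(X,H)$ (i.e. faithful actions of $H$ on a set $X$) for which $D_H(X)=c$. If for at least one pair $(X,H)\in A$ the action of $H$ on $X$ can be extended to a faithful action of $\Gamma$ on $X$, then $\overline{D}(H)\leq\overline{D}(\Gamma)$.
   Context: For a group $G$ acting faithfully on a set $X$, $D_G(X)$ is the least $r$ such that there is a surjection $\phi:X\to\{1,\ldots,r\}$ whose only preserving element ($g$ with $\phi(g.x)=\phi(x)$ for all $x$) is the identity. $\overline{D}(G)=\max\{D_G(X):\ G \text{ acts faithfully on } X\}$. -}

module Defs where

open import Level using (0ℓ)
open import Data.Nat using (ℕ; _≤_; _<_)
open import Data.Fin using (Fin)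
open import Data.Product using (Σ; ∃; _×_; _,_)
open import Relation.Binary.PropositionalEquality using (_≡_)
open import Relation.Nullary using (¬_)
open import Algebra.Bundles using (Group)
open import Algebra.Morphism.Structures using (module GroupMorphisms)

IsFiniteGroup : Group 0ℓ 0ℓ → Set
IsFiniteGroup G = ∃ λ (n : ℕ) → Σ (Fin n → Carrier) λ f → ∀ g → ∃ λ i → f i ≈ g
  where open Group G

record Action (G : Group 0ℓ 0ℓ) (X : Set) : Set where
  open Group G
  field
    act      : Carrier → X → X
    act-cong : ∀ {g h} → g ≈ h → ∀ x → act g x ≡ act h x
    act-id   : ∀ x → act ε x ≡ x
    act-comp : ∀ g h x → act (g ∙ h) x ≡ act g (act h x)

Faithful : {G : Group 0ℓ 0ℓ} {X : Set} → Action G X → Set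
Faithful {G} α = ∀ g → (∀ x → act g x ≡ x) → g ≈ ε
  where open Group G ; open Action α

Distinguishing : {G : Group 0ℓ 0ℓ} {X : Set} → Action G X → (r : ℕ) → (X → Fin r) → Set
Distinguishing {G} α r φ =
  (∀ i → ∃ λ x → φ x ≡ i) ×
  (∀ g → (∀ x → φ (act g x) ≡ φ x) → g ≈ ε)
  where open Group G ; open Action α

HasDist : {G : Group 0ℓ 0ℓ} {X : Set} → Action G X → ℕ → Set
HasDist {X = X} α r = Σ (X → Fin r) λ φ → Distinguishing α r φ

DNumber : {G : Group 0ℓ 0ℓ} {X : Set} → Action G X → ℕ → Set
DNumber α d = HasDist α d × (∀ r → r < d → ¬ HasDist α r)

DBarEq : Group 0ℓ 0ℓ → ℕ → Set₁
DBarEq G c =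
  (∀ (X : Set) (α : Action G X) → Faithful α → ∃ λ r → r ≤ c × DNumber α r) ×
  (Σ Set λ X → Σ (Action G X) λ α → Faithful α × DNumber α c)

-- c ≤ D̄(G) (with D̄(G) ∈ ℕ ∪ {∞}): some faithful action has no distinguishing
-- surjection onto {1,…,r} for any r < c, i.e. D_G(X) ≥ c (or D_G(X) undefined = ∞).
DBarGeq : Group 0ℓ 0ℓ → ℕ → Set₁
DBarGeq G c = Σ Set λ X → Σ (Action G X) λ α → Faithful α × (∀ r → r < c → ¬ HasDist α r)

IsSubgroupEmbedding : (H Γ : Group 0ℓ 0ℓ) → (Group.Carrier H → Group.Carrier Γ) → Set
IsSubgroupEmbedding H Γ ι = GroupMorphisms.IsGroupMonomorphism (Group.rawGroup H) (Group.rawGroup Γ) ι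

Extends : {H Γ : Group 0ℓ 0ℓ} {X : Set} (ι : Group.Carrier H → Group.Carrier Γ) →
          Action Γ X → Action H X → Set
Extends {H} ι β α = ∀ h x → Action.act β (ι h) x ≡ Action.act α h x

-- A distinguishing surjection φ for the extended Γ-action on X is distinguishing for H:
-- an h ∈ H preserving φ gives ι h ∈ Γ preserving φ, so ι h = ε and h = ε by injectivity.
-- Hence D_Γ(X) ≥ D_H(X) = c for this faithful Γ-action, i.e. D̄(Γ) ≥ c.
module Submission where

open import Defs
open import Level using (0ℓ)
open import Data.Nat using (ℕ)
open import Data.Fin using (Fin)
open import Data.Product using (Σ; _×_; _,_)
open import Algebra.Bundles using (Group)
open import Relation.Binary.PropositionalEquality using (trans; cong)
open import Relation.Nullary using (¬_)
open import Algebra.Morphism.Structures using (module GroupMorphisms)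

module _ {H Γ : Group 0ℓ 0ℓ} {X : Set} (ι : Group.Carrier H → Group.Carrier Γ)
         (mono : IsSubgroupEmbedding H Γ ι)
         (α : Action H X) (β : Action Γ X) (ext : Extends ι β α) where

  distinguishing-restrict : ∀ {r} {φ : X → Fin r} → Distinguishing β r φ → Distinguishing α r φ
  distinguishing-restrict {φ = φ} (surj , pres) =
    surj , λ h h-preserves →
      injective (Γ.trans (pres (ι h) (λ x → trans (cong φ (ext h x)) (h-preserves x))) (Γ.sym ε-homo))
    where
      module Γ = Group Γ
      open GroupMorphisms.IsGroupMonomorphism mono

  ¬hasDist-extend : ∀ {r} → ¬ HasDist α r → ¬ HasDist β r
  ¬hasDist-extend ¬dist-α (φ , dist) = ¬dist-α (φ , distinguishing-restrict dist)

mainTheorem6 : (Γ H : Group 0ℓ 0ℓ) → IsFiniteGroup Γ →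
    (ι : Group.Carrier H → Group.Carrier Γ) → IsSubgroupEmbedding H Γ ι →
    (c : ℕ) → DBarEq H c →
    (Σ Set λ X → Σ (Action H X) λ α → Faithful α × DNumber α c ×
    (Σ (Action Γ X) λ β → Faithful β × Extends ι β α)) →
    DBarGeq Γ c
mainTheorem6 Γ H _ ι mono c _ (X , α , _ , (_ , minimal) , β , faithful-β , ext) =
  X , β , faithful-β , λ r r<c → ¬hasDist-extend ι mono α β ext (minimal r r<c)
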